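{- Let $\vec k$ be a vector of positive integers with $\ell(\vec k)=1$ or $2$. Then $\mathrm{depth}(\pi)=\mathrm{bounce}(\pi)$ for every $\pi\in\mathcal{D}_{\vec k}$. In particular $$\widetilde{C}_{\vec k}(q,t):=\sum_{\pi\in\mathcal{D}_{\vec k}}q^{\mathrm{area}(\pi)}t^{\mathrm{depth}(\pi)}=\sum_{\pi\in\mathcal{D}_{\vec k}}q^{\mathrm{area}(\pi)}t^{\mathrm{bounce}(\pi)}=:C_{\vec k}(q,t).$$
   Context: For a vector $\vec{k}=(k_1,\dots,k_\ell)$ of positive integers, $\ell(\vec k)=\ell$, $N=|\vec k|+\ell$. A $\vec{k}$-Dyck path is a word $\pi=\pi_1\cdots\pi_N$ consisting of the letters $S^{k_1},\dots,S^{k_\ell}$, each exactly once and in this order from left to right, together with $|\vec k|$ letters $W$, such that the starting ranks $r_1=0$, $r_{i+1}=r_i+k_j$ if $\pi_i=S^{k_j}$, $r_{i+1}=r_i-1$ if $\pi_i=W$, are all nonnegative. $\mathcal{D}_{\vec k}$ is the set of $\vec k$-Dyck paths. The area sequence is $(a_1,\dots,a_\ell)$ with $a_j=r_i$ where $\pi_i=S^{k_j}$; $\mathrm{area}(\pi)=\sum_j a_j$. Filling algorithms: in a tableau of $\ell$ top-justified columns, column $i$ with $k_i+1$ cells, place $1,\dots,N$ successively: $1$ at the top of column 1; for $i\ge2$, if $\pi_i$ is an $S$-letter put $i$ at the top of the leftmost empty column, and if $\pi_i=W$ put $i$ immediately below an active entry (an entry is active if it is currently the bottom-most entry of its column $j$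 and that column has fewer than $k_j+1$ entries). Choosing the smallest active entry each time gives $\eta(\pi)$; choosing the largest active entry each time gives $\eta_*(\pi)$. Ranking of a filled tableau: column 1 gets ranks $0,1,\dots,k_1$ top to bottom; for $i\ge2$, if the top entry of column $i$ is $A+1$ and $A$ has rank $\alpha$, column $i$ gets ranks $\alpha,\dots,\alpha+k_i$ top to bottom. $\mathrm{bounce}(\pi)$ is the sum of the ranks of the first-row cells of $\eta(\pi)$, and $\mathrm{depth}(\pi)$ is the sum of the ranks of the first-row cells of $\eta_*(\pi)$. -}

module Defs where

open import Data.Nat using (ℕ; zero; suc; _+_; _∸_; _⊓_; _⊔_; _≤_; _<ᵇ_; _≡ᵇ_)
open import Data.Integer as ℤ using (ℤ; +_; 0ℤ; 1ℤ)
open import Data.List using (List; []; _∷_; _++_; [_]; length; map)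
open import Data.Nat.ListAction using (sum)
open import Data.List.Relation.Unary.All using (All)
open import Data.Maybe using (Maybe; just; nothing)
open import Data.Bool using (Bool; true; false; if_then_else_)
open import Data.Product using (_×_; _,_)
open import Relation.Binary.PropositionalEquality using (_≡_)

-- Words.  The S-letters of a k-Dyck path are S^{k_1},…,S^{k_ℓ} in this
-- order, so a word is determined by the positions of S versus W; the
-- j-th occurrence of S stands for S^{k_j}.

data Letter : Set where
  S W : Letter

countS : List Letter → ℕ
countS []      = 0
countS (S ∷ π) = suc (countS π)
countS (W ∷ π) = countS π

countW : List Letter → ℕ
countW []      = 0
countW (S ∷ π) = countW π
countW (W ∷ π) = suc (countW π)

-- Starting ranks r_1,…,r_N (given current rank r and remaining k's).
-- (The clause for an S with no k left is unreachable for k-Dyck paths.)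
rankSeq : List ℕ → ℤ → List Letter → List ℤ
rankSeq ks       r []      = []
rankSeq []       r (S ∷ π) = r ∷ rankSeq [] r π
rankSeq (k ∷ ks) r (S ∷ π) = r ∷ rankSeq ks (r ℤ.+ + k) π
rankSeq ks       r (W ∷ π) = r ∷ rankSeq ks (r ℤ.- 1ℤ) π

IsDyck : List ℕ → List Letter → Set
IsDyck ks π = (countS π ≡ length ks) × (countW π ≡ sum ks)
            × All (ℤ._≤_ 0ℤ) (rankSeq ks 0ℤ π)

areaSeq : List Letter → List ℤ → List ℤ
areaSeq (S ∷ π) (r ∷ rs) = r ∷ areaSeq π rs
areaSeq (W ∷ π) (r ∷ rs) = areaSeq π rs
areaSeq _       _        = []

area : List ℕ → List Letter → ℤ
area ks π = Data.List.foldr ℤ._+_ 0ℤ (areaSeq π (rankSeq ks 0ℤ π))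

-- Tableaux: a list of columns, each (k_j , entries from top to bottom).

Column : Set
Column = ℕ × List ℕ

last? : List ℕ → Maybe ℕ
last? []       = nothing
last? (x ∷ []) = just x
last? (x ∷ xs) = last? xs

activeBottom : Column → Maybe ℕ
activeBottom (k , es) = if length es <ᵇ suc k then last? es else nothing

placeTop : ℕ → List Column → List Column
placeTop i []              = []
placeTop i ((k , []) ∷ cs) = (k , i ∷ []) ∷ cs
placeTop i ((k , e ∷ es) ∷ cs) = (k , e ∷ es) ∷ placeTop i cs

chooseActive : (ℕ → ℕ → ℕ) → List Column → Maybe ℕ
chooseActive op []       = nothing
chooseActive op (c ∷ cs) with activeBottom c | chooseActive op cs
... | nothing | m      = m
... | just a  | nothing = just a
... | just a  | just b  = just (op a b)

appendBelow : ℕ → ℕ → List Column → List Column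
appendBelow m i [] = []
appendBelow m i ((k , es) ∷ cs) with activeBottom (k , es)
... | just b  = if b ≡ᵇ m then (k , es ++ [ i ]) ∷ cs
                          else (k , es) ∷ appendBelow m i cs
... | nothing = (k , es) ∷ appendBelow m i cs

placeBelow : (ℕ → ℕ → ℕ) → ℕ → List Column → List Column
placeBelow op i cs with chooseActive op cs
... | just m  = appendBelow m i cs
... | nothing = cs   -- unreachable for k-Dyck paths

fillGo : (ℕ → ℕ → ℕ) → ℕ → List Letter → List Column → List Column
fillGo op i []      cs = cs
fillGo op i (S ∷ π) cs = fillGo op (suc i) π (placeTop i cs)
fillGo op i (W ∷ π) cs = fillGo op (suc i) π (placeBelow op i cs)

fill : (ℕ → ℕ → ℕ) → List ℕ → List Letter → List (List ℕ)
fill op ks π = map (λ c → Data.Product.proj₂ c)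
                   (fillGo op 1 π (map (λ k → (k , [])) ks))

η : List ℕ → List Letter → List (List ℕ)
η = fill _⊓_

η* : List ℕ → List Letter → List (List ℕ)
η* = fill _⊔_

indexOf : ℕ → List ℕ → Maybe ℕ
indexOf a []       = nothing
indexOf a (x ∷ xs) = if x ≡ᵇ a then just 0 else Data.Maybe.map suc (indexOf a xs)

-- rank of the cell containing a, among already ranked columns (entries, α)
rankOf : ℕ → List (List ℕ × ℕ) → ℕ
rankOf a [] = 0
rankOf a ((es , α) ∷ rest) with indexOf a es
... | just r  = α + r
... | nothing = rankOf a rest

top : List ℕ → ℕ
top []      = 0
top (e ∷ _) = e

topRanksGo : List (List ℕ × ℕ) → List (List ℕ) → List ℕ
topRanksGo acc       []          = []
topRanksGo []        (es ∷ rest) = 0 ∷ topRanksGo ((es , 0) ∷ []) rest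
topRanksGo (c ∷ acc) (es ∷ rest) =
  let α = rankOf (top es ∸ 1) (c ∷ acc)
  in α ∷ topRanksGo ((c ∷ acc) ++ [ (es , α) ]) rest

firstRowRanks : List (List ℕ) → List ℕ
firstRowRanks = topRanksGo []

bounce : List ℕ → List Letter → ℕ
bounce ks π = sum (firstRowRanks (η ks π))

depth : List ℕ → List Letter → ℕ
depth ks π = sum (firstRowRanks (η* ks π))

{-# OPTIONS --safe #-}
-- For one column every first-row rank is 0. For two columns, only column 1 can hold an
-- active entry until the second S-letter, say at step i, so the two filling rules agree
-- up to that step. Afterwards both rules only append entries larger than i, so the rank
-- of i − 1 in column 1, which is the rank of the top cell of column 2, is fixed at step i.
module Submission where

open import Defs
open import Data.Nat using (ℕ; _≤_)
open import Data.List using (List; length)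
open import Data.List.Relation.Unary.All using (All)
open import Data.Sum using (_⊎_)
open import Relation.Binary.PropositionalEquality using (_≡_)

open import Data.Nat using (suc; _+_; _∸_; _<_; _⊓_; _⊔_; _≡ᵇ_; s≤s)
open import Data.Nat.Properties
  using (≤-refl; ≤-trans; <-≤-trans; n≤1+n; m∸n≤m; >⇒≢; ≡ᵇ⇒≡; ≡⇒≡ᵇ; +-identityʳ)
open import Data.Nat.ListAction using (sum)
open import Data.Bool using (true; false)
open import Data.Bool.Properties using (T-≡)
open import Data.Empty using (⊥-elim)
open import Data.List using ([]; _∷_; _++_; [_]; map)
open import Data.List.Properties using (++-identityʳ; ++-assoc)
open import Data.List.Relation.Unary.All using ([]; _∷_)
import Data.List.Relation.Unary.All as All
open import Data.List.Relation.Unary.All.Properties using (++⁺)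
open import Data.List.Relation.Binary.Pointwise using (Pointwise; []; _∷_)
import Data.List.Relation.Binary.Pointwise as Pointwise
open import Data.Maybe using (just; nothing)
import Data.Maybe as Maybe
open import Data.Product using (_,_; proj₂)
open import Data.Sum using (inj₁; inj₂)
open import Function using (_∘_; Equivalence)
open import Relation.Binary.PropositionalEquality
  using (_≢_; refl; sym; trans; cong; subst; module ≡-Reasoning)

data Grows (i : ℕ) : Column → Column → Set where
  grows : ∀ {k es} (Q : List ℕ) → All (i ≤_) Q → Grows i (k , es) (k , es ++ Q)

Grows-refl : ∀ {i c} → Grows i c c
Grows-refl {i} {k , es} = subst (Grows i (k , es) ∘ (k ,_)) (++-identityʳ es) (grows [] [])

Grows-trans : ∀ {i j c c′ c″} → i ≤ j → Grows i c c′ → Grows j c′ c″ → Grows i c c″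
Grows-trans {i} i≤j (grows {k} {es} Q q) (grows Q′ q′) =
  subst (Grows i (k , es) ∘ (k ,_)) (sym (++-assoc es Q Q′))
        (grows (Q ++ Q′) (++⁺ q (All.map (≤-trans i≤j) q′)))

Extends : ℕ → List Column → List Column → Set
Extends i = Pointwise (Grows i)

Extends-refl : ∀ {i cs} → Extends i cs cs
Extends-refl = Pointwise.refl Grows-refl

Extends-trans : ∀ {i j cs cs′ cs″} → i ≤ j → Extends i cs cs′ → Extends j cs′ cs″ → Extends i cs cs″
Extends-trans i≤j = Pointwise.transitive (Grows-trans i≤j)

placeTop-extends : ∀ i cs → Extends i cs (placeTop i cs)
placeTop-extends i []                  = []
placeTop-extends i ((k , [])     ∷ cs) = grows [ i ] (≤-refl ∷ []) ∷ Extends-refl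
placeTop-extends i ((k , e ∷ es) ∷ cs) = Grows-refl ∷ placeTop-extends i cs

appendBelow-extends : ∀ m i cs → Extends i cs (appendBelow m i cs)
appendBelow-extends m i [] = []
appendBelow-extends m i ((k , es) ∷ cs) with activeBottom (k , es)
... | nothing = Grows-refl ∷ appendBelow-extends m i cs
... | just b with b ≡ᵇ m
...   | true  = grows [ i ] (≤-refl ∷ []) ∷ Extends-refl
...   | false = Grows-refl ∷ appendBelow-extends m i cs

placeBelow-extends : ∀ op i cs → Extends i cs (placeBelow op i cs)
placeBelow-extends op i cs with chooseActive op cs
... | just m  = appendBelow-extends m i cs
... | nothing = Extends-refl

fillGo-extends : ∀ op i π cs → Extends i cs (fillGo op i π cs)
fillGo-extends op i []      cs = Extends-refl
fillGo-extends op i (S ∷ π) cs =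
  Extends-trans (n≤1+n i) (placeTop-extends i cs) (fillGo-extends op (suc i) π (placeTop i cs))
fillGo-extends op i (W ∷ π) cs =
  Extends-trans (n≤1+n i) (placeBelow-extends op i cs) (fillGo-extends op (suc i) π (placeBelow op i cs))

indexOf-absent : ∀ {a ys} → All (_≢ a) ys → indexOf a ys ≡ nothing
indexOf-absent [] = refl
indexOf-absent {a} {y ∷ ys} (y≢a ∷ ys≢a) with y ≡ᵇ a | ≡ᵇ⇒≡ y a
... | true  | y≡a = ⊥-elim (y≢a (y≡a _))
... | false | _   = cong (Maybe.map suc) (indexOf-absent ys≢a)

indexOf-++ : ∀ {a} xs {ys} → All (_≢ a) ys → indexOf a (xs ++ ys) ≡ indexOf a xs
indexOf-++ []       ys≢a = indexOf-absent ys≢a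
indexOf-++ (x ∷ xs) ys≢a rewrite indexOf-++ xs ys≢a = refl

rankOf-++ : ∀ {a} es {Q} α rest → All (_≢ a) Q → rankOf a ((es ++ Q , α) ∷ rest) ≡ rankOf a ((es , α) ∷ rest)
rankOf-++ es α rest Q≢a rewrite indexOf-++ es Q≢a = refl

topRankSum : List Column → ℕ
topRankSum = sum ∘ firstRowRanks ∘ map proj₂

topRankSum-oneColumn : ∀ {i c cs} → Extends i (c ∷ []) cs → topRankSum cs ≡ 0
topRankSum-oneColumn (_ ∷ []) = refl

topRankSum-twoColumns : ∀ {i k₁ e r k₂ cs} → Extends (suc i) ((k₁ , e ∷ r) ∷ (k₂ , i ∷ []) ∷ []) cs
                      → topRankSum cs ≡ rankOf (i ∸ 1) ((e ∷ r , 0) ∷ [])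
topRankSum-twoColumns {i} {e = e} {r} (grows Q i<Q ∷ grows _ _ ∷ []) = begin
  rankOf (i ∸ 1) ((e ∷ r ++ Q , 0) ∷ []) + 0 ≡⟨ +-identityʳ _ ⟩
  rankOf (i ∸ 1) ((e ∷ r ++ Q , 0) ∷ [])     ≡⟨ rankOf-++ (e ∷ r) 0 [] (All.map (>⇒≢ ∘ i∸1<) i<Q) ⟩
  rankOf (i ∸ 1) ((e ∷ r , 0) ∷ [])          ∎
  where
  open ≡-Reasoning
  i∸1< : ∀ {y} → suc i ≤ y → i ∸ 1 < y
  i∸1< = <-≤-trans (s≤s (m∸n≤m i 1))

appendToActive : ℕ → Column → Column
appendToActive i (k , es) with activeBottom (k , es)
... | just _  = k , es ++ [ i ]
... | nothing = k , es

appendBelow-active : ∀ {b} i k es cs → activeBottom (k , es) ≡ just b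
                   → appendBelow b i ((k , es) ∷ cs) ≡ (k , es ++ [ i ]) ∷ cs
appendBelow-active {b} i k es cs active rewrite active | Equivalence.to T-≡ (≡⇒≡ᵇ b b refl) = refl

placeBelow-secondEmpty : ∀ op i c k → placeBelow op i (c ∷ (k , []) ∷ []) ≡ appendToActive i c ∷ (k , []) ∷ []
placeBelow-secondEmpty op i (k₁ , es) k with activeBottom (k₁ , es) in active
... | nothing = refl
... | just b  = appendBelow-active i k₁ es _ active

topRankSum-fillGo-op-irrelevant : ∀ op op′ i π c k →
  topRankSum (fillGo op i π (c ∷ (k , []) ∷ [])) ≡ topRankSum (fillGo op′ i π (c ∷ (k , []) ∷ []))
topRankSum-fillGo-op-irrelevant op op′ i []      c            k = refl
topRankSum-fillGo-op-irrelevant op op′ i (S ∷ π) (k₁ , [])    k =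
  topRankSum-fillGo-op-irrelevant op op′ (suc i) π (k₁ , i ∷ []) k
topRankSum-fillGo-op-irrelevant op op′ i (S ∷ π) (k₁ , e ∷ r) k =
  trans (topRankSum-twoColumns (fillGo-extends op (suc i) π _))
        (sym (topRankSum-twoColumns (fillGo-extends op′ (suc i) π _)))
topRankSum-fillGo-op-irrelevant op op′ i (W ∷ π) c            k
  rewrite placeBelow-secondEmpty op i c k | placeBelow-secondEmpty op′ i c k =
  topRankSum-fillGo-op-irrelevant op op′ (suc i) π (appendToActive i c) k

proposition5p5 : (ks : List ℕ) → All (λ k → 1 ≤ k) ks
    → (length ks ≡ 1 ⊎ length ks ≡ 2)
    → (π : List Letter) → IsDyck ks π
    → depth ks π ≡ bounce ks π
proposition5p5 (k ∷ []) _ _ π _ =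
  trans (topRankSum-oneColumn (fillGo-extends _⊔_ 1 π _))
        (sym (topRankSum-oneColumn (fillGo-extends _⊓_ 1 π _)))
proposition5p5 (k₁ ∷ k₂ ∷ []) _ _ π _ = topRankSum-fillGo-op-irrelevant _⊔_ _⊓_ 1 π (k₁ , []) k₂
proposition5p5 []              _ (inj₁ ()) _ _
proposition5p5 []              _ (inj₂ ()) _ _
proposition5p5 (_ ∷ _ ∷ _ ∷ _) _ (inj₁ ()) _ _
proposition5p5 (_ ∷ _ ∷ _ ∷ _) _ (inj₂ ()) _ _
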